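{- If $t=t_1\rightthreetimes t_2\rightthreetimes\cdots\rightthreetimes t_r$ with each $t_i\in\mathbf{PBT}_{n_i}$ $\rightthreetimes$-irreducible, then $M_t=M_{t_1}\rightthreetimes M_{t_2}\rightthreetimes\cdots\rightthreetimes M_{t_r}$.
   Context: Planar binary rooted trees: every internal vertex has two children; $\mathbf{PBT}_n$ = such trees with $n$ leaves, $\mathbf{PBT}_1=\{\vert\}$. $t\veebar w$ joins the roots of $t$ (left), $w$ (right) to a new root; $t\circ_1w$ identifies the root of $w$ with the leftmost leaf of $t$; $t\rightthreetimes w=w\circ_1(t\veebar\vert)$, extended bilinearly (it is associative). A tree $t$ is $\rightthreetimes$-irreducible if there are no trees $u,w$ with $t=u\rightthreetimes w$. Tamari order $\le_T$ on $\mathbf{PBT}_n$: generated by $(t_1\veebar t_2)\veebar t_3\le_Tt_1\veebar(t_2\veebar t_3)$ and by $t_1\le_Tw_1,t_2\le_Tw_2\Rightarrow t_1\veebar t_2\le_Tw_1\veebar w_2$; $M_t=\sum_{w\le_Tt}\mu(w,t)w$, $\mu$ its Möbius function. -}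

module Defs where

open import Data.Nat using (ℕ; zero; suc; _+_; _∸_)
open import Data.Integer using (ℤ; _*_; 0ℤ; 1ℤ) renaming (_+_ to _+ℤ_)
open import Data.List using (List; []; _∷_; [_]; map; concatMap; filter; foldl; upTo)
open import Data.Product using (_×_; _,_; Σ; ∃₂)
open import Relation.Binary.PropositionalEquality using (_≡_; _≢_)
open import Relation.Binary.Definitions using (Decidable)
open import Relation.Nullary using (¬_; Dec; yes; no)
open import Relation.Nullary.Decidable using (_×-dec_)

data Tree : Set where
  leaf : Tree
  node : Tree → Tree → Tree

leaves : Tree → ℕ
leaves leaf       = 1
leaves (node l r) = leaves l + leaves r

_∨_ : Tree → Tree → Tree
t ∨ w = node t w

-- t ∘₁ w : identify the root of w with the leftmost leaf of t
_∘₁_ : Tree → Tree → Tree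
leaf     ∘₁ w = w
node l r ∘₁ w = node (l ∘₁ w) r

_⋌_ : Tree → Tree → Tree
t ⋌ w = w ∘₁ (t ∨ leaf)

Irreducible : Tree → Set
Irreducible t = ¬ (∃₂ λ u w → t ≡ u ⋌ w)

-- the product t₁ ⋌ t₂ ⋌ ⋯ ⋌ tᵣ (left bracketing; ⋌ is associative)
⋌-prod : Tree → List Tree → Tree
⋌-prod t₁ ts = foldl _⋌_ t₁ ts

-- Enumeration of PBT_n (all trees with n leaves), by fuel f ≥ n

treesF : ℕ → ℕ → List Tree
treesF zero    n             = []
treesF (suc f) zero          = []
treesF (suc f) (suc zero)    = leaf ∷ []
treesF (suc f) (suc (suc m)) =
  concatMap (λ k → concatMap (λ l → map (λ r → node l r) (treesF f (suc (suc m) ∸ suc k)))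
                             (treesF f (suc k)))
            (upTo (suc m))

PBT : ℕ → List Tree
PBT n = treesF n n

infix 4 _≤T_
data _≤T_ : Tree → Tree → Set where
  ≤T-refl  : ∀ {t} → t ≤T t
  ≤T-trans : ∀ {t u w} → t ≤T u → u ≤T w → t ≤T w
  ≤T-rot   : ∀ {t₁ t₂ t₃} → (t₁ ∨ t₂) ∨ t₃ ≤T t₁ ∨ (t₂ ∨ t₃)
  ≤T-∨     : ∀ {t₁ t₂ w₁ w₂} → t₁ ≤T w₁ → t₂ ≤T w₂ → t₁ ∨ t₂ ≤T w₁ ∨ w₂

-- Möbius function of the Tamari order (computed relative to any
-- decision procedure for ≤T; the Tamari order on PBT_n is finite, hence
-- decidable, and the result does not depend on the chosen decider).

module Tamari (_≤T?_ : Decidable _≤T_) where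

  interval : Tree → Tree → List Tree
  interval x y = filter (λ z → (x ≤T? z) ×-dec (z ≤T? y)) (PBT (leaves x))

  sumℤ : List ℤ → ℤ
  sumℤ []       = 0ℤ
  sumℤ (a ∷ as) = a +ℤ sumℤ as

  IsMöbius : (Tree → Tree → ℤ) → Set
  IsMöbius μ = (∀ x → μ x x ≡ 1ℤ)
             × (∀ x y → x ≤T y → x ≢ y → sumℤ (map (μ x) (interval x y)) ≡ 0ℤ)

  LC : Set
  LC = List (ℤ × Tree)

  _⋌L_ : LC → LC → LC
  A ⋌L B = concatMap (λ { (a , u) → map (λ { (b , w) → (a * b , u ⋌ w) }) B }) A

  ⋌L-prod : LC → List LC → LC
  ⋌L-prod A As = foldl _⋌L_ A As

  M : (Tree → Tree → ℤ) → Tree → LC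
  M μ t = map (λ w → (μ w t , w)) (filter (λ w → w ≤T? t) (PBT (leaves t)))

_≟T_ : (t w : Tree) → Dec (t ≡ w)
leaf ≟T leaf = yes Relation.Binary.PropositionalEquality.refl
leaf ≟T node _ _ = no (λ ())
node _ _ ≟T leaf = no (λ ())
node l r ≟T node l' r' with l ≟T l' | r ≟T r'
... | yes Relation.Binary.PropositionalEquality.refl | yes Relation.Binary.PropositionalEquality.refl = yes Relation.Binary.PropositionalEquality.refl
... | no p | _ = no (λ { Relation.Binary.PropositionalEquality.refl → p Relation.Binary.PropositionalEquality.refl })
... | yes _ | no q = no (λ { Relation.Binary.PropositionalEquality.refl → q Relation.Binary.PropositionalEquality.refl })

coeff : List (ℤ × Tree) → Tree → ℤ
coeff []             w = 0ℤ
coeff ((a , u) ∷ A) w with u ≟T w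
... | yes _ = a +ℤ coeff A w
... | no  _ = coeff A w

-- equality of linear combinations (as elements of the free ℤ-module on trees)
infix 4 _≈L_
_≈L_ : List (ℤ × Tree) → List (ℤ × Tree) → Set
A ≈L B = ∀ w → coeff A w ≡ coeff B w

-- The map (u′ , w′) ↦ u′ ⋌ w′ is an isomorphism from the product of the principal down-sets of
-- u and w onto the principal down-set of u ⋌ w: ⋌ is monotone, it is injective once the number of
-- leaves of the left factor is fixed, and every x ≤ u ⋌ w factors as u′ ⋌ w′ with u′ ≤ u, w′ ≤ w.
-- As for any product of posets, the Möbius function is then multiplicative,
-- μ (u₀ ⋌ w₀) (u ⋌ w) = μ u₀ u · μ w₀ w, and comparing coefficients gives M (u ⋌ w) = M u ⋌ M w
-- for all trees u and w. Sums over PBT n and its sublists are compared through multiplicities,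
-- each tree with n leaves occurring exactly once in PBT n.
module Submission where

open import Defs
open import Data.Bool using (if_then_else_)
open import Data.Empty using (⊥-elim)
open import Data.Integer using (ℤ; 0ℤ; 1ℤ; _+_; _*_; _-_; -_)
import Data.Integer.Properties as ℤₚ
open import Data.Integer.Tactic.RingSolver using (solve-∀)
open import Data.List using (List; []; _∷_; _++_; map; concatMap; filter; length; upTo)
import Data.List.Properties as Listₚ
open import Data.List.Membership.Propositional using (_∈_)
open import Data.List.Membership.Propositional.Properties using (∈-filter⁻; ∈-upTo⁻)
open import Data.List.Relation.Unary.All using (All)
open import Data.List.Relation.Unary.Any using (here; there)
open import Data.Nat as ℕ using (ℕ; zero; suc; _<_; _∸_; z≤n; s≤s)
open import Data.Nat.Induction using (<-wellFounded)
import Data.Nat.Properties as ℕₚ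
open import Data.Nat.Tactic.RingSolver using () renaming (solve-∀ to ℕsolve-∀)
open import Data.Product using (_×_; _,_; proj₁; proj₂)
open import Data.Sum using (_⊎_; inj₁; inj₂; [_,_]′)
open import Function using (_∘_)
open import Induction.WellFounded using (Acc; acc)
open import Relation.Binary.Definitions using (Decidable)
open import Relation.Binary.PropositionalEquality
open import Relation.Nullary using (Dec; does; yes; no; ¬_; ¬?)
open import Relation.Nullary.Decidable using (_×-dec_)
open ≡-Reasoning

private
  variable
    A B C : Set
    P Q : Set

-- Indicators and finite sums

-- Defined through does, so that 𝟙 (suc m ℕ.≟ suc n) reduces to 𝟙 (m ℕ.≟ n).
𝟙 : Dec P → ℤ
𝟙 d = if does d then 1ℤ else 0ℤ

𝟙-yes : (d : Dec P) → P → 𝟙 d ≡ 1ℤ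
𝟙-yes (yes _) _ = refl
𝟙-yes (no ¬p) p = ⊥-elim (¬p p)

𝟙-no : (d : Dec P) → ¬ P → 𝟙 d ≡ 0ℤ
𝟙-no (yes p) ¬p = ⊥-elim (¬p p)
𝟙-no (no _)  _  = refl

𝟙-⇔ : (P → Q) → (Q → P) → (p : Dec P) (q : Dec Q) → 𝟙 p ≡ 𝟙 q
𝟙-⇔ to from (yes p) q = sym (𝟙-yes q (to p))
𝟙-⇔ to from (no ¬p) q = sym (𝟙-no q (¬p ∘ from))

𝟙-× : (p : Dec P) (q : Dec Q) → 𝟙 (p ×-dec q) ≡ 𝟙 p * 𝟙 q
𝟙-× (yes _) (yes _) = refl
𝟙-× (yes _) (no _)  = refl
𝟙-× (no _)  _       = refl

𝟙-distrib-* : ∀ {m a b} (p : Dec P) (q : Dec Q) → (P → Q → m ≡ a * b) →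
  𝟙 p * 𝟙 q * m ≡ 𝟙 p * a * (𝟙 q * b)
𝟙-distrib-* {m = m} {a} {b} (yes p) (yes q) m≡ab =
  trans (ℤₚ.*-identityˡ m) (trans (m≡ab p q) (sym (cong₂ _*_ (ℤₚ.*-identityˡ a) (ℤₚ.*-identityˡ b))))
𝟙-distrib-* {a = a} (yes _) (no _) _ = sym (ℤₚ.*-zeroʳ (1ℤ * a))
𝟙-distrib-* (no _) _ _ = refl

∑ : List A → (A → ℤ) → ℤ
∑ []       f = 0ℤ
∑ (x ∷ xs) f = f x + ∑ xs f

syntax ∑ xs (λ x → e) = ∑[ x ∈ xs ] e

∑-cong : ∀ {f g : A → ℤ} xs → (∀ {x} → x ∈ xs → f x ≡ g x) → ∑ xs f ≡ ∑ xs g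
∑-cong []       f≗g = refl
∑-cong (x ∷ xs) f≗g = cong₂ _+_ (f≗g (here refl)) (∑-cong xs (f≗g ∘ there))

∑-zero : ∀ {f : A → ℤ} xs → (∀ {x} → x ∈ xs → f x ≡ 0ℤ) → ∑ xs f ≡ 0ℤ
∑-zero []       f≗0 = refl
∑-zero (x ∷ xs) f≗0 = cong₂ _+_ (f≗0 (here refl)) (∑-zero xs (f≗0 ∘ there))

∑-+ : ∀ xs (f g : A → ℤ) → ∑[ x ∈ xs ] (f x + g x) ≡ ∑ xs f + ∑ xs g
∑-+ []       f g = refl
∑-+ (x ∷ xs) f g = trans (cong (f x + g x +_) (∑-+ xs f g)) (swap (f x) (g x) (∑ xs f) (∑ xs g))
  where
  swap : ∀ a b c d → a + b + (c + d) ≡ a + c + (b + d)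
  swap = solve-∀

∑∑-+ : ∀ xs ys (f g : A → B → ℤ) →
  ∑[ x ∈ xs ] ∑[ y ∈ ys ] (f x y + g x y)
    ≡ ∑[ x ∈ xs ] ∑[ y ∈ ys ] f x y + ∑[ x ∈ xs ] ∑[ y ∈ ys ] g x y
∑∑-+ xs ys f g =
  trans (∑-cong xs λ {x} _ → ∑-+ ys (f x) (g x)) (∑-+ xs (λ x → ∑ ys (f x)) (λ x → ∑ ys (g x)))

∑-*ˡ : ∀ c xs (f : A → ℤ) → c * ∑ xs f ≡ ∑[ x ∈ xs ] (c * f x)
∑-*ˡ c []       f = ℤₚ.*-zeroʳ c
∑-*ˡ c (x ∷ xs) f = trans (ℤₚ.*-distribˡ-+ c (f x) (∑ xs f)) (cong (c * f x +_) (∑-*ˡ c xs f))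

∑-*ʳ : ∀ c xs (f : A → ℤ) → ∑ xs f * c ≡ ∑[ x ∈ xs ] (f x * c)
∑-*ʳ c xs f =
  trans (ℤₚ.*-comm (∑ xs f) c) (trans (∑-*ˡ c xs f) (∑-cong xs λ {x} _ → ℤₚ.*-comm c (f x)))

∑-*-∑ : ∀ xs ys (f : A → ℤ) (g : B → ℤ) → ∑[ x ∈ xs ] ∑[ y ∈ ys ] (f x * g y) ≡ ∑ xs f * ∑ ys g
∑-*-∑ xs ys f g = sym (trans (∑-*ʳ (∑ ys g) xs f) (∑-cong xs λ {x} _ → ∑-*ˡ (f x) ys g))

∑-++ : ∀ xs ys (f : A → ℤ) → ∑ (xs ++ ys) f ≡ ∑ xs f + ∑ ys f
∑-++ []       ys f = sym (ℤₚ.+-identityˡ (∑ ys f))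
∑-++ (x ∷ xs) ys f =
  trans (cong (f x +_) (∑-++ xs ys f)) (sym (ℤₚ.+-assoc (f x) (∑ xs f) (∑ ys f)))

∑-map : ∀ (g : A → B) xs f → ∑ (map g xs) f ≡ ∑ xs (f ∘ g)
∑-map g []       f = refl
∑-map g (x ∷ xs) f = cong (f (g x) +_) (∑-map g xs f)

∑-concatMap : ∀ (g : A → List B) xs f → ∑ (concatMap g xs) f ≡ ∑[ x ∈ xs ] ∑ (g x) f
∑-concatMap g []       f = refl
∑-concatMap g (x ∷ xs) f =
  trans (∑-++ (g x) (concatMap g xs) f) (cong (∑ (g x) f +_) (∑-concatMap g xs f))

∑-concatMap-map : ∀ (_·_ : A → B → C) xs ys f →
  ∑ (concatMap (λ x → map (x ·_) ys) xs) f ≡ ∑[ x ∈ xs ] ∑[ y ∈ ys ] f (x · y)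
∑-concatMap-map _·_ xs ys f =
  trans (∑-concatMap (λ x → map (x ·_) ys) xs f) (∑-cong xs λ {x} _ → ∑-map (x ·_) ys f)

∑-filter : ∀ {P : A → Set} (P? : ∀ x → Dec (P x)) xs f →
  ∑ (filter P? xs) f ≡ ∑[ x ∈ xs ] (𝟙 (P? x) * f x)
∑-filter P? []       f = refl
∑-filter P? (x ∷ xs) f with P? x
... | yes _ = cong₂ _+_ (sym (ℤₚ.*-identityˡ (f x))) (∑-filter P? xs f)
... | no  _ = trans (∑-filter P? xs f) (sym (ℤₚ.+-identityˡ _))

∑-upTo-suc : ∀ N (f : ℕ → ℤ) → ∑ (upTo (suc N)) f ≡ f 0 + ∑[ k ∈ upTo N ] f (suc k)
∑-upTo-suc N f =
  cong (f 0 +_) (trans (cong (λ ks → ∑ ks f) (sym (Listₚ.map-upTo suc N))) (∑-map suc (upTo N) f))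

∑-upTo-split : ∀ N {a b} → 0 < a → 0 < b →
  ∑[ k ∈ upTo N ] (𝟙 (a ℕ.≟ suc k) * 𝟙 (b ℕ.≟ N ∸ k)) ≡ 𝟙 (a ℕ.+ b ℕ.≟ suc N)
∑-upTo-split N       {zero}        ()  _
∑-upTo-split N       {suc a} {zero} _  ()
∑-upTo-split zero    {suc a} {suc b} _ _ =
  sym (𝟙-no (suc a ℕ.+ suc b ℕ.≟ 1) (ℕₚ.m+1+n≢0 a ∘ ℕₚ.suc-injective))
∑-upTo-split (suc N) {suc zero} {suc b} _ _ = begin
  ∑[ k ∈ upTo (suc N) ] (𝟙 (1 ℕ.≟ suc k) * 𝟙 (suc b ℕ.≟ suc N ∸ k))
    ≡⟨ ∑-upTo-suc N (λ k → 𝟙 (1 ℕ.≟ suc k) * 𝟙 (suc b ℕ.≟ suc N ∸ k)) ⟩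
  1ℤ * 𝟙 (b ℕ.≟ N) + ∑[ k ∈ upTo N ] 0ℤ
    ≡⟨ cong₂ _+_ (ℤₚ.*-identityˡ (𝟙 (b ℕ.≟ N))) (∑-zero (upTo N) (λ _ → refl)) ⟩
  𝟙 (b ℕ.≟ N) + 0ℤ
    ≡⟨ ℤₚ.+-identityʳ _ ⟩
  𝟙 (b ℕ.≟ N)
    ∎
∑-upTo-split (suc N) {suc (suc a)} {suc b} _ 0<b = begin
  ∑[ k ∈ upTo (suc N) ] (𝟙 (suc (suc a) ℕ.≟ suc k) * 𝟙 (suc b ℕ.≟ suc N ∸ k))
    ≡⟨ ∑-upTo-suc N (λ k → 𝟙 (suc (suc a) ℕ.≟ suc k) * 𝟙 (suc b ℕ.≟ suc N ∸ k)) ⟩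
  0ℤ + ∑[ k ∈ upTo N ] (𝟙 (suc a ℕ.≟ suc k) * 𝟙 (suc b ℕ.≟ N ∸ k))
    ≡⟨ ℤₚ.+-identityˡ _ ⟩
  ∑[ k ∈ upTo N ] (𝟙 (suc a ℕ.≟ suc k) * 𝟙 (suc b ℕ.≟ N ∸ k))
    ≡⟨ ∑-upTo-split N {suc a} ℕ.z<s 0<b ⟩
  𝟙 (suc a ℕ.+ suc b ℕ.≟ suc N)
    ∎

-- Leaves, the product ⋌ and the Tamari order

leaves-pos : ∀ t → 0 < leaves t
leaves-pos leaf       = s≤s z≤n
leaves-pos (node l r) = ℕₚ.<-≤-trans (leaves-pos l) (ℕₚ.m≤m+n (leaves l) (leaves r))

1<leaves-node : ∀ l r → 1 < leaves (node l r)
1<leaves-node l r = ℕₚ.+-mono-≤ (leaves-pos l) (leaves-pos r)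

leaves≡1⇒leaf : ∀ t → leaves t ≡ 1 → t ≡ leaf
leaves≡1⇒leaf leaf       _ = refl
leaves≡1⇒leaf (node l r) e = ⊥-elim (ℕₚ.>⇒≢ (1<leaves-node l r) e)

leaves-⋌ : ∀ u w → leaves (u ⋌ w) ≡ leaves u ℕ.+ leaves w
leaves-⋌ u leaf       = refl
leaves-⋌ u (node a b) =
  trans (cong (ℕ._+ leaves b) (leaves-⋌ u a)) (ℕₚ.+-assoc (leaves u) (leaves a) (leaves b))

≤T-leaves : ∀ {x y} → x ≤T y → leaves x ≡ leaves y
≤T-leaves ≤T-refl                 = refl
≤T-leaves (≤T-trans p q)          = trans (≤T-leaves p) (≤T-leaves q)
≤T-leaves (≤T-rot {t₁} {t₂} {t₃}) = ℕₚ.+-assoc (leaves t₁) (leaves t₂) (leaves t₃)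
≤T-leaves (≤T-∨ p q)              = cong₂ ℕ._+_ (≤T-leaves p) (≤T-leaves q)

≤T-leaf : ∀ {x} → x ≤T leaf → x ≡ leaf
≤T-leaf p = leaves≡1⇒leaf _ (≤T-leaves p)

node-injective : ∀ {l r l′ r′} → node l r ≡ node l′ r′ → l ≡ l′ × r ≡ r′
node-injective refl = refl , refl

leaves-<-⋌ : ∀ u w → leaves u < leaves (u ⋌ w)
leaves-<-⋌ u w = subst (leaves u <_) (sym (leaves-⋌ u w)) (ℕₚ.m<m+n (leaves u) (leaves-pos w))

≢-⋌ : ∀ {u} u′ w′ → leaves u ≡ leaves u′ → u ≢ u′ ⋌ w′
≢-⋌ u′ w′ ∣u∣ e = ℕₚ.<-irrefl (sym (trans (cong leaves (sym e)) ∣u∣)) (leaves-<-⋌ u′ w′)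

⋌-injective : ∀ {u w u′ w′} → leaves u ≡ leaves u′ → u ⋌ w ≡ u′ ⋌ w′ → u ≡ u′ × w ≡ w′
⋌-injective {w = leaf}     {w′ = leaf}       _   e = proj₁ (node-injective e) , refl
⋌-injective {w = leaf}     {u′} {node a′ _}  ∣u∣ e =
  ⊥-elim (≢-⋌ u′ a′ ∣u∣ (proj₁ (node-injective e)))
⋌-injective {u} {node a _} {w′ = leaf}       ∣u∣ e =
  ⊥-elim (≢-⋌ u a (sym ∣u∣) (sym (proj₁ (node-injective e))))
⋌-injective {u} {node a b} {u′} {node a′ b′} ∣u∣ e with node-injective e
... | e₁ , refl with ⋌-injective {u} {a} {u′} {a′} ∣u∣ e₁
...   | refl , refl = refl , refl

∘₁-monoˡ : ∀ {w′ w} s → w′ ≤T w → w′ ∘₁ s ≤T w ∘₁ s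
∘₁-monoˡ s ≤T-refl        = ≤T-refl
∘₁-monoˡ s (≤T-trans p q) = ≤T-trans (∘₁-monoˡ s p) (∘₁-monoˡ s q)
∘₁-monoˡ s ≤T-rot         = ≤T-rot
∘₁-monoˡ s (≤T-∨ p q)     = ≤T-∨ (∘₁-monoˡ s p) q

∘₁-monoʳ : ∀ w {s′ s} → s′ ≤T s → w ∘₁ s′ ≤T w ∘₁ s
∘₁-monoʳ leaf       p = p
∘₁-monoʳ (node l r) p = ≤T-∨ (∘₁-monoʳ l p) ≤T-refl

⋌-mono : ∀ {u′ u w′ w} → u′ ≤T u → w′ ≤T w → u′ ⋌ w′ ≤T u ⋌ w
⋌-mono {u′} {w = w} p q = ≤T-trans (∘₁-monoˡ (u′ ∨ leaf) q) (∘₁-monoʳ w (≤T-∨ p ≤T-refl))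

data ⋌-Below (u w x : Tree) : Set where
  below : ∀ {u′ w′} → x ≡ u′ ⋌ w′ → u′ ≤T u → w′ ≤T w → ⋌-Below u w x

≤T-⋌-factorise : ∀ {x y} u w → x ≤T y → y ≡ u ⋌ w → ⋌-Below u w x
≤T-⋌-factorise u w ≤T-refl e = below e ≤T-refl ≤T-refl
≤T-⋌-factorise u w (≤T-trans p q) e with ≤T-⋌-factorise u w q e
... | below {u₁} {w₁} e₁ u₁≤u w₁≤w with ≤T-⋌-factorise u₁ w₁ p e₁
...   | below e₂ u₂≤u₁ w₂≤w₁ = below e₂ (≤T-trans u₂≤u₁ u₁≤u) (≤T-trans w₂≤w₁ w₁≤w)
≤T-⋌-factorise u leaf       ≤T-rot ()
≤T-⋌-factorise u (node a b) ≤T-rot refl = below refl ≤T-refl ≤T-rot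
≤T-⋌-factorise u leaf       (≤T-∨ p q) refl = below (cong (node _) (≤T-leaf q)) p ≤T-refl
≤T-⋌-factorise u (node a b) (≤T-∨ {t₂ = t₂} p q) refl with ≤T-⋌-factorise u a p refl
... | below e u′≤u a′≤a = below (cong (λ t → node t t₂) e) u′≤u (≤T-∨ a′≤a q)

⋌-reflects-≤T : ∀ {u′ w′ u w} → leaves u′ ≡ leaves u → u′ ⋌ w′ ≤T u ⋌ w → u′ ≤T u × w′ ≤T w
⋌-reflects-≤T ∣u′∣ p with ≤T-⋌-factorise _ _ p refl
... | below e u₁≤u w₁≤w with ⋌-injective (trans ∣u′∣ (sym (≤T-leaves u₁≤u))) e
...   | refl , refl = u₁≤u , w₁≤w

-- A rotation raises the rank by the number of leaves of t₃.
rank : Tree → ℕ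
rank leaf       = 0
rank (node l r) = rank l ℕ.+ rank r ℕ.+ leaves r

≤T-rank : ∀ {x y} → x ≤T y → x ≡ y ⊎ rank x < rank y
≤T-rank ≤T-refl = inj₁ refl
≤T-rank (≤T-trans p q) with ≤T-rank p | ≤T-rank q
... | inj₁ refl | r         = r
... | inj₂ r    | inj₁ refl = inj₂ r
... | inj₂ r    | inj₂ s    = inj₂ (ℕₚ.<-trans r s)
≤T-rank (≤T-rot {t₁} {t₂} {t₃}) =
  inj₂ (subst (rank ((t₁ ∨ t₂) ∨ t₃) <_)
              (rotation (rank t₁) (rank t₂) (leaves t₂) (rank t₃) (leaves t₃))
              (ℕₚ.m<m+n _ (leaves-pos t₃)))
  where
  rotation : ∀ a b c d e → a ℕ.+ b ℕ.+ c ℕ.+ d ℕ.+ e ℕ.+ e ≡ a ℕ.+ (b ℕ.+ d ℕ.+ e) ℕ.+ (c ℕ.+ e)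
  rotation = ℕsolve-∀
≤T-rank (≤T-∨ {t₁} {t₂} p q) with ≤T-rank p | ≤T-rank q
... | inj₁ refl | inj₁ refl = inj₁ refl
... | inj₁ refl | inj₂ r    =
  inj₂ (ℕₚ.+-mono-<-≤ (ℕₚ.+-monoʳ-< (rank t₁) r) (ℕₚ.≤-reflexive (≤T-leaves q)))
... | inj₂ r    | inj₁ refl = inj₂ (ℕₚ.+-monoˡ-< (leaves t₂) (ℕₚ.+-monoˡ-< (rank t₂) r))
... | inj₂ r    | inj₂ s    =
  inj₂ (ℕₚ.+-mono-<-≤ (ℕₚ.+-mono-< r s) (ℕₚ.≤-reflexive (≤T-leaves q)))

rank-+-< : ∀ {u′ u w′ w} → u′ ≤T u → w′ ≤T w → u′ ≢ u ⊎ w′ ≢ w →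
  rank u′ ℕ.+ rank w′ < rank u ℕ.+ rank w
rank-+-< p q off-top with ≤T-rank p | ≤T-rank q
... | inj₁ refl | inj₁ refl = ⊥-elim ([ (λ u≢u → u≢u refl) , (λ w≢w → w≢w refl) ]′ off-top)
... | inj₁ refl | inj₂ r    = ℕₚ.+-monoʳ-< _ r
... | inj₂ r    | inj₁ refl = ℕₚ.+-monoˡ-< _ r
... | inj₂ r    | inj₂ s    = ℕₚ.+-mono-< r s

-- Multiplicities and the enumeration PBT n

δ : Tree → Tree → ℤ
δ u z = 𝟙 (u ≟T z)

δ-pair : ∀ (_·_ : Tree → Tree → Tree) {a b c d} → (a · b ≡ c · d → a ≡ c × b ≡ d) →
  δ (a · b) (c · d) ≡ δ a c * δ b d
δ-pair _·_ {a} {b} {c} {d} ·-injective =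
  trans (𝟙-⇔ ·-injective (λ (e₁ , e₂) → cong₂ _·_ e₁ e₂) ((a · b) ≟T (c · d)) ((a ≟T c) ×-dec (b ≟T d)))
        (𝟙-× (a ≟T c) (b ≟T d))

δ-subst : ∀ u z (f : Tree → ℤ) → δ u z * f u ≡ δ u z * f z
δ-subst u z f with u ≟T z
... | yes refl = refl
... | no _     = refl

multiplicity : List Tree → Tree → ℤ
multiplicity xs z = ∑[ u ∈ xs ] δ u z

∑-δ : ∀ xs z (f : Tree → ℤ) → ∑[ u ∈ xs ] (δ u z * f u) ≡ multiplicity xs z * f z
∑-δ xs z f = trans (∑-cong xs (λ {u} _ → δ-subst u z f)) (sym (∑-*ʳ (f z) xs (λ u → δ u z)))

multiplicity-filter : ∀ {P : Tree → Set} (P? : ∀ x → Dec (P x)) xs z →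
  multiplicity (filter P? xs) z ≡ 𝟙 (P? z) * multiplicity xs z
multiplicity-filter P? xs z = begin
  multiplicity (filter P? xs) z   ≡⟨ ∑-filter P? xs (λ u → δ u z) ⟩
  ∑[ u ∈ xs ] (𝟙 (P? u) * δ u z)  ≡⟨ ∑-cong xs (λ {u} _ → ℤₚ.*-comm (𝟙 (P? u)) (δ u z)) ⟩
  ∑[ u ∈ xs ] (δ u z * 𝟙 (P? u))  ≡⟨ ∑-δ xs z (𝟙 ∘ P?) ⟩
  multiplicity xs z * 𝟙 (P? z)    ≡⟨ ℤₚ.*-comm (multiplicity xs z) (𝟙 (P? z)) ⟩
  𝟙 (P? z) * multiplicity xs z    ∎

nodes : List Tree → List Tree → List Tree
nodes ls rs = concatMap (λ l → map (node l) rs) ls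

multiplicity-nodes-leaf : ∀ ls rs → multiplicity (nodes ls rs) leaf ≡ 0ℤ
multiplicity-nodes-leaf ls rs =
  trans (∑-concatMap-map node ls rs (λ u → δ u leaf)) (∑-zero ls (λ _ → ∑-zero rs (λ _ → refl)))

multiplicity-nodes-node : ∀ ls rs l₀ r₀ →
  multiplicity (nodes ls rs) (node l₀ r₀) ≡ multiplicity ls l₀ * multiplicity rs r₀
multiplicity-nodes-node ls rs l₀ r₀ = begin
  multiplicity (nodes ls rs) (node l₀ r₀)
    ≡⟨ ∑-concatMap-map node ls rs (λ u → δ u (node l₀ r₀)) ⟩
  ∑[ l ∈ ls ] ∑[ r ∈ rs ] δ (node l r) (node l₀ r₀)
    ≡⟨ ∑-cong ls (λ {l} _ → ∑-cong rs λ {r} _ → δ-pair node {l} {r} {l₀} {r₀} node-injective) ⟩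
  ∑[ l ∈ ls ] ∑[ r ∈ rs ] (δ l l₀ * δ r r₀)
    ≡⟨ ∑-*-∑ ls rs (λ l → δ l l₀) (λ r → δ r r₀) ⟩
  multiplicity ls l₀ * multiplicity rs r₀
    ∎

treesF-split : ℕ → ℕ → ℕ → List Tree
treesF-split f m k = nodes (treesF f (suc k)) (treesF f (suc m ∸ k))

multiplicity-treesF : ∀ {f n} → n ℕ.≤ f → ∀ z → multiplicity (treesF f n) z ≡ 𝟙 (leaves z ℕ.≟ n)
multiplicity-treesF {zero}  {zero}     _ z = sym (𝟙-no (leaves z ℕ.≟ 0) (ℕₚ.>⇒≢ (leaves-pos z)))
multiplicity-treesF {suc f} {zero}     _ z = sym (𝟙-no (leaves z ℕ.≟ 0) (ℕₚ.>⇒≢ (leaves-pos z)))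
multiplicity-treesF {suc f} {suc zero} _ leaf       = refl
multiplicity-treesF {suc f} {suc zero} _ (node l r) =
  sym (𝟙-no (leaves (node l r) ℕ.≟ 1) (ℕₚ.>⇒≢ (1<leaves-node l r)))
multiplicity-treesF {suc f} {suc (suc m)} _ leaf =
  trans (∑-concatMap (treesF-split f m) (upTo (suc m)) (λ u → δ u leaf))
        (∑-zero (upTo (suc m)) (λ {k} _ → multiplicity-nodes-leaf (treesF f (suc k)) (treesF f (suc m ∸ k))))
multiplicity-treesF {suc f} {suc (suc m)} (s≤s m+1≤f) (node l₀ r₀) = begin
  multiplicity (treesF (suc f) (suc (suc m))) (node l₀ r₀)
    ≡⟨ ∑-concatMap (treesF-split f m) (upTo (suc m)) (λ u → δ u (node l₀ r₀)) ⟩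
  ∑[ k ∈ upTo (suc m) ] multiplicity (treesF-split f m k) (node l₀ r₀)
    ≡⟨ ∑-cong (upTo (suc m)) split ⟩
  ∑[ k ∈ upTo (suc m) ] (𝟙 (leaves l₀ ℕ.≟ suc k) * 𝟙 (leaves r₀ ℕ.≟ suc m ∸ k))
    ≡⟨ ∑-upTo-split (suc m) (leaves-pos l₀) (leaves-pos r₀) ⟩
  𝟙 (leaves l₀ ℕ.+ leaves r₀ ℕ.≟ suc (suc m))
    ∎
  where
  split : ∀ {k} → k ∈ upTo (suc m) →
    multiplicity (treesF-split f m k) (node l₀ r₀) ≡ 𝟙 (leaves l₀ ℕ.≟ suc k) * 𝟙 (leaves r₀ ℕ.≟ suc m ∸ k)
  split {k} k∈ = trans (multiplicity-nodes-node (treesF f (suc k)) (treesF f (suc m ∸ k)) l₀ r₀)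
    (cong₂ _*_ (multiplicity-treesF (ℕₚ.≤-trans (∈-upTo⁻ k∈) m+1≤f) l₀)
               (multiplicity-treesF (ℕₚ.≤-trans (ℕₚ.m∸n≤m (suc m) k) m+1≤f) r₀))

multiplicity-PBT : ∀ n z → multiplicity (PBT n) z ≡ 𝟙 (leaves z ℕ.≟ n)
multiplicity-PBT n = multiplicity-treesF ℕₚ.≤-refl

-- Linear combinations of trees

eval : (Tree → ℤ) → List (ℤ × Tree) → ℤ
eval f A = ∑ A (λ (a , u) → a * f u)

coeff-∷ : ∀ a u A z → coeff ((a , u) ∷ A) z ≡ a * δ u z + coeff A z
coeff-∷ a u A z with u ≟T z
... | yes _ = cong (_+ coeff A z) (sym (ℤₚ.*-identityʳ a))
... | no  _ = sym (trans (cong (_+ coeff A z) (ℤₚ.*-zeroʳ a)) (ℤₚ.+-identityˡ _))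

coeff-as-eval : ∀ A z → coeff A z ≡ eval (λ u → δ u z) A
coeff-as-eval []            z = refl
coeff-as-eval ((a , u) ∷ A) z = trans (coeff-∷ a u A z) (cong (a * δ u z +_) (coeff-as-eval A z))

remove : Tree → List (ℤ × Tree) → List (ℤ × Tree)
remove v = filter (λ (_ , u) → ¬? (u ≟T v))

coeff-remove : ∀ v A z → coeff (remove v A) z ≡ 𝟙 (¬? (z ≟T v)) * coeff A z
coeff-remove v A z = begin
  coeff (remove v A) z
    ≡⟨ coeff-as-eval (remove v A) z ⟩
  eval (λ u → δ u z) (remove v A)
    ≡⟨ ∑-filter (λ (_ , u) → ¬? (u ≟T v)) A (λ (a , u) → a * δ u z) ⟩
  ∑ A (λ (a , u) → 𝟙 (¬? (u ≟T v)) * (a * δ u z))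
    ≡⟨ ∑-cong A (λ {(a , u)} _ → move a u) ⟩
  ∑ A (λ (a , u) → 𝟙 (¬? (z ≟T v)) * (a * δ u z))
    ≡⟨ ∑-*ˡ (𝟙 (¬? (z ≟T v))) A (λ (a , u) → a * δ u z) ⟨
  𝟙 (¬? (z ≟T v)) * eval (λ u → δ u z) A
    ≡⟨ cong (𝟙 (¬? (z ≟T v)) *_) (coeff-as-eval A z) ⟨
  𝟙 (¬? (z ≟T v)) * coeff A z
    ∎
  where
  move : ∀ a u → 𝟙 (¬? (u ≟T v)) * (a * δ u z) ≡ 𝟙 (¬? (z ≟T v)) * (a * δ u z)
  move a u with u ≟T z
  ... | yes refl = refl
  ... | no  _    = both-zero (𝟙 (¬? (u ≟T v))) (𝟙 (¬? (z ≟T v))) a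
    where
    both-zero : ∀ x y a → x * (a * 0ℤ) ≡ y * (a * 0ℤ)
    both-zero = solve-∀

eval-remove : ∀ f v A → eval f A ≡ coeff A v * f v + eval f (remove v A)
eval-remove f v []            = refl
eval-remove f v ((a , u) ∷ A) with u ≟T v
... | yes refl =
  trans (cong (a * f u +_) (eval-remove f u A)) (collect a (coeff A u) (f u) (eval f (remove u A)))
  where
  collect : ∀ a c x s → a * x + (c * x + s) ≡ (a + c) * x + s
  collect = solve-∀
... | no  _ =
  trans (cong (a * f u +_) (eval-remove f v A)) (swap (a * f u) (coeff A v * f v) (eval f (remove v A)))
  where
  swap : ∀ x y s → x + (y + s) ≡ y + (x + s)
  swap = solve-∀

Null : List (ℤ × Tree) → Set
Null A = ∀ z → coeff A z ≡ 0ℤ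

eval-null : ∀ f A → Null A → eval f A ≡ 0ℤ
eval-null f A = go A (<-wellFounded (length A))
  where
  go : ∀ A → Acc _<_ (length A) → Null A → eval f A ≡ 0ℤ
  go []              _        _    = refl
  go A@((a , u) ∷ _) (acc rs) null = begin
    eval f A                               ≡⟨ eval-remove f u A ⟩
    coeff A u * f u + eval f (remove u A)  ≡⟨ cong₂ _+_ (cong (_* f u) (null u))
                                                        (go (remove u A) (rs shorter) null′) ⟩
    0ℤ                                     ∎
    where
    shorter : length (remove u A) < length A
    shorter = Listₚ.filter-notAll (λ (_ , u′) → ¬? (u′ ≟T u)) A (here (λ u≢u → u≢u refl))
    null′ : Null (remove u A)
    null′ z = trans (coeff-remove u A z)
                    (trans (cong (𝟙 (¬? (z ≟T u)) *_) (null z)) (ℤₚ.*-zeroʳ (𝟙 (¬? (z ≟T u)))))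

eval-cong : ∀ f A B → A ≈L B → eval f A ≡ eval f B
eval-cong f []            B A≈B = sym (eval-null f B (λ z → sym (A≈B z)))
eval-cong f ((a , u) ∷ A) B A≈B = begin
  a * f u + eval f A                ≡⟨ cong (a * f u +_) (eval-cong f A ((- a , u) ∷ B) A≈B′) ⟩
  a * f u + (- a * f u + eval f B)  ≡⟨ cancel a (f u) (eval f B) ⟩
  eval f B                          ∎
  where
  cancel : ∀ a x s → a * x + (- a * x + s) ≡ s
  cancel = solve-∀
  A≈B′ : A ≈L ((- a , u) ∷ B)
  A≈B′ z = begin
    coeff A z                              ≡⟨ neg-cancel a (δ u z) (coeff A z) ⟩
    - a * δ u z + (a * δ u z + coeff A z)  ≡⟨ cong (- a * δ u z +_) (trans (sym (coeff-∷ a u A z)) (A≈B z)) ⟩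
    - a * δ u z + coeff B z                ≡⟨ coeff-∷ (- a) u B z ⟨
    coeff ((- a , u) ∷ B) z                ∎
    where
    neg-cancel : ∀ a d c → c ≡ - a * d + (a * d + c)
    neg-cancel = solve-∀

formal-sum : List Tree → List (ℤ × Tree)
formal-sum = map (λ z → 1ℤ , z)

eval-formal-sum : ∀ (f : Tree → ℤ) xs → eval f (formal-sum xs) ≡ ∑ xs f
eval-formal-sum f xs =
  trans (∑-map (λ z → 1ℤ , z) xs (λ (a , u) → a * f u)) (∑-cong xs λ {x} _ → ℤₚ.*-identityˡ (f x))

∑-multiplicity-cong : ∀ xs ys f → (∀ z → multiplicity xs z ≡ multiplicity ys z) → ∑ xs f ≡ ∑ ys f
∑-multiplicity-cong xs ys f xs≈ys = begin
  ∑ xs f                  ≡⟨ eval-formal-sum f xs ⟨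
  eval f (formal-sum xs)  ≡⟨ eval-cong f (formal-sum xs) (formal-sum ys) formal-sums-≈ ⟩
  eval f (formal-sum ys)  ≡⟨ eval-formal-sum f ys ⟩
  ∑ ys f                  ∎
  where
  coeff-formal-sum : ∀ zs z → coeff (formal-sum zs) z ≡ multiplicity zs z
  coeff-formal-sum zs z = trans (coeff-as-eval (formal-sum zs) z) (eval-formal-sum (λ u → δ u z) zs)
  formal-sums-≈ : formal-sum xs ≈L formal-sum ys
  formal-sums-≈ z = trans (coeff-formal-sum xs z) (trans (xs≈ys z) (sym (coeff-formal-sum ys z)))

-- Down-sets and the Möbius function

module _ (_≤T?_ : Decidable _≤T_) where
  open Tamari _≤T?_

  ↓ : Tree → List Tree
  ↓ t = filter (_≤T? t) (PBT (leaves t))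

  ∈↓⇒≤T : ∀ {z} t → z ∈ ↓ t → z ≤T t
  ∈↓⇒≤T t z∈ = proj₂ (∈-filter⁻ (_≤T? t) {xs = PBT (leaves t)} z∈)

  multiplicity-↓ : ∀ t z → multiplicity (↓ t) z ≡ 𝟙 (z ≤T? t)
  multiplicity-↓ t z = trans (multiplicity-filter (_≤T? t) (PBT (leaves t)) z) (once (z ≤T? t))
    where
    once : (d : Dec (z ≤T t)) → 𝟙 d * multiplicity (PBT (leaves t)) z ≡ 𝟙 d
    once (yes z≤t) = trans (ℤₚ.*-identityˡ _) (trans (multiplicity-PBT (leaves t) z)
                                                     (𝟙-yes (leaves z ℕ.≟ leaves t) (≤T-leaves z≤t)))
    once (no _)    = refl

  multiplicity-↓-top : ∀ t → multiplicity (↓ t) t ≡ 1ℤ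
  multiplicity-↓-top t = trans (multiplicity-↓ t t) (𝟙-yes (t ≤T? t) ≤T-refl)

  𝟙-≤T-⋌ : ∀ {u′ w′ u w} → leaves u′ ≡ leaves u →
    𝟙 ((u′ ⋌ w′) ≤T? (u ⋌ w)) ≡ 𝟙 (u′ ≤T? u) * 𝟙 (w′ ≤T? w)
  𝟙-≤T-⋌ {u′} {w′} {u} {w} ∣u′∣ =
    trans (𝟙-⇔ (⋌-reflects-≤T ∣u′∣) (λ (p , q) → ⋌-mono p q)
               ((u′ ⋌ w′) ≤T? (u ⋌ w)) ((u′ ≤T? u) ×-dec (w′ ≤T? w)))
          (𝟙-× (u′ ≤T? u) (w′ ≤T? w))

  ⋌-image : Tree → Tree → List Tree
  ⋌-image u w = concatMap (λ u′ → map (u′ ⋌_) (↓ w)) (↓ u)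

  multiplicity-⋌-image : ∀ u w z → multiplicity (⋌-image u w) z ≡ 𝟙 (z ≤T? (u ⋌ w))
  multiplicity-⋌-image u w z =
    trans (∑-concatMap-map _⋌_ (↓ u) (↓ w) (λ v → δ v z)) (count (z ≤T? (u ⋌ w)))
    where
    count : (d : Dec (z ≤T u ⋌ w)) → ∑[ u′ ∈ ↓ u ] ∑[ w′ ∈ ↓ w ] δ (u′ ⋌ w′) z ≡ 𝟙 d
    count (no z≰uw) = ∑-zero (↓ u) λ {u′} u′∈ → ∑-zero (↓ w) λ {w′} w′∈ →
      𝟙-no ((u′ ⋌ w′) ≟T z) (λ { refl → z≰uw (⋌-mono (∈↓⇒≤T u u′∈) (∈↓⇒≤T w w′∈)) })
    count (yes z≤uw) with ≤T-⋌-factorise u w z≤uw refl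
    ... | below {u₁} {w₁} refl u₁≤u w₁≤w = begin
      ∑[ u′ ∈ ↓ u ] ∑[ w′ ∈ ↓ w ] δ (u′ ⋌ w′) (u₁ ⋌ w₁)
        ≡⟨ ∑-cong (↓ u) (λ {u′} u′∈ → ∑-cong (↓ w) λ {w′} _ →
             δ-pair _⋌_ {u′} {w′} {u₁} {w₁} (⋌-injective (∣u′∣ u′∈))) ⟩
      ∑[ u′ ∈ ↓ u ] ∑[ w′ ∈ ↓ w ] (δ u′ u₁ * δ w′ w₁)
        ≡⟨ ∑-*-∑ (↓ u) (↓ w) (λ u′ → δ u′ u₁) (λ w′ → δ w′ w₁) ⟩
      multiplicity (↓ u) u₁ * multiplicity (↓ w) w₁
        ≡⟨ cong₂ _*_ (multiplicity-↓ u u₁) (multiplicity-↓ w w₁) ⟩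
      𝟙 (u₁ ≤T? u) * 𝟙 (w₁ ≤T? w)
        ≡⟨ cong₂ _*_ (𝟙-yes (u₁ ≤T? u) u₁≤u) (𝟙-yes (w₁ ≤T? w) w₁≤w) ⟩
      1ℤ
        ∎
      where
      ∣u′∣ : ∀ {u′} → u′ ∈ ↓ u → leaves u′ ≡ leaves u₁
      ∣u′∣ u′∈ = trans (≤T-leaves (∈↓⇒≤T u u′∈)) (sym (≤T-leaves u₁≤u))

  ∑-↓-⋌ : ∀ u w f → ∑ (↓ (u ⋌ w)) f ≡ ∑[ u′ ∈ ↓ u ] ∑[ w′ ∈ ↓ w ] f (u′ ⋌ w′)
  ∑-↓-⋌ u w f =
    trans (∑-multiplicity-cong (↓ (u ⋌ w)) (⋌-image u w) f
            (λ z → trans (multiplicity-↓ (u ⋌ w) z) (sym (multiplicity-⋌-image u w z))))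
          (∑-concatMap-map _⋌_ (↓ u) (↓ w) f)

  eval-M : ∀ μ t (f : Tree → ℤ) → eval f (M μ t) ≡ ∑[ z ∈ ↓ t ] (μ z t * f z)
  eval-M μ t f = ∑-map (λ z → μ z t , z) (↓ t) (λ (a , u) → a * f u)

  eval-⋌L : ∀ f A B → eval f (A ⋌L B) ≡ eval (λ u → eval (λ w → f (u ⋌ w)) B) A
  eval-⋌L f []            B = refl
  eval-⋌L f ((a , u) ∷ A) B =
    trans (∑-++ (map _ B) (A ⋌L B) _) (cong₂ _+_ (trans (∑-map _ B _) scale) (eval-⋌L f A B))
    where
    scale : ∑ B (λ (b , w) → a * b * f (u ⋌ w)) ≡ a * eval (λ w → f (u ⋌ w)) B
    scale = trans (∑-cong B λ {(b , w)} _ → ℤₚ.*-assoc a b (f (u ⋌ w)))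
                  (sym (∑-*ˡ a B (λ (b , w) → b * f (u ⋌ w))))

  coeff-⋌L : ∀ A B x → coeff (A ⋌L B) x ≡ eval (λ u → eval (λ w → δ (u ⋌ w) x) B) A
  coeff-⋌L A B x = trans (coeff-as-eval (A ⋌L B) x) (eval-⋌L (λ z → δ z x) A B)

  ⋌L-congˡ : ∀ A A′ B → A ≈L A′ → (A ⋌L B) ≈L (A′ ⋌L B)
  ⋌L-congˡ A A′ B A≈A′ x =
    trans (coeff-⋌L A B x) (trans (eval-cong _ A A′ A≈A′) (sym (coeff-⋌L A′ B x)))

  sumℤ-map : ∀ (f : Tree → ℤ) xs → sumℤ (map f xs) ≡ ∑ xs f
  sumℤ-map f []       = refl
  sumℤ-map f (x ∷ xs) = cong (f x +_) (sumℤ-map f xs)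

  sumℤ-interval : ∀ {x y} (f : Tree → ℤ) → leaves x ≡ leaves y →
    sumℤ (map f (interval x y)) ≡ ∑[ z ∈ ↓ y ] (𝟙 (x ≤T? z) * f z)
  sumℤ-interval {x} {y} f ∣x∣≡∣y∣ = begin
    sumℤ (map f (interval x y))
      ≡⟨ sumℤ-map f (interval x y) ⟩
    ∑ (interval x y) f
      ≡⟨ ∑-filter (λ z → (x ≤T? z) ×-dec (z ≤T? y)) (PBT (leaves x)) f ⟩
    ∑[ z ∈ PBT (leaves x) ] (𝟙 ((x ≤T? z) ×-dec (z ≤T? y)) * f z)
      ≡⟨ cong (λ n → ∑[ z ∈ PBT n ] (𝟙 ((x ≤T? z) ×-dec (z ≤T? y)) * f z)) ∣x∣≡∣y∣ ⟩
    ∑[ z ∈ PBT (leaves y) ] (𝟙 ((x ≤T? z) ×-dec (z ≤T? y)) * f z)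
      ≡⟨ ∑-cong (PBT (leaves y)) (λ {z} _ → reorder z) ⟩
    ∑[ z ∈ PBT (leaves y) ] (𝟙 (z ≤T? y) * (𝟙 (x ≤T? z) * f z))
      ≡⟨ ∑-filter (_≤T? y) (PBT (leaves y)) (λ z → 𝟙 (x ≤T? z) * f z) ⟨
    ∑[ z ∈ ↓ y ] (𝟙 (x ≤T? z) * f z)
      ∎
    where
    reorder : ∀ z → 𝟙 ((x ≤T? z) ×-dec (z ≤T? y)) * f z ≡ 𝟙 (z ≤T? y) * (𝟙 (x ≤T? z) * f z)
    reorder z =
      trans (cong (_* f z) (𝟙-× (x ≤T? z) (z ≤T? y))) (swap (𝟙 (x ≤T? z)) (𝟙 (z ≤T? y)) (f z))
      where
      swap : ∀ a b c → a * b * c ≡ b * (a * c)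
      swap = solve-∀

  module _ (μ : Tree → Tree → ℤ) (isMöbius : IsMöbius μ) where

    μ↑ : Tree → Tree → ℤ
    μ↑ x z = 𝟙 (x ≤T? z) * μ x z

    μ↑-≤T : ∀ {x z} → x ≤T z → μ↑ x z ≡ μ x z
    μ↑-≤T {x} {z} x≤z = trans (cong (_* μ x z) (𝟙-yes (x ≤T? z) x≤z)) (ℤₚ.*-identityˡ (μ x z))

    ∑-↓-μ↑ : ∀ {x y} → x ≤T y → x ≢ y → ∑ (↓ y) (μ↑ x) ≡ 0ℤ
    ∑-↓-μ↑ {x} {y} x≤y x≢y =
      trans (sym (sumℤ-interval {x} {y} (μ x) (≤T-leaves x≤y))) (proj₂ isMöbius x y x≤y x≢y)

    μ↑-⋌ : ∀ {u₀ w₀ u w} → leaves u₀ ≡ leaves u →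
      (u₀ ≤T u → w₀ ≤T w → μ (u₀ ⋌ w₀) (u ⋌ w) ≡ μ u₀ u * μ w₀ w) →
      μ↑ (u₀ ⋌ w₀) (u ⋌ w) ≡ μ↑ u₀ u * μ↑ w₀ w
    μ↑-⋌ {u₀} {w₀} {u} {w} ∣u₀∣ μ-⋌ =
      trans (cong (_* μ (u₀ ⋌ w₀) (u ⋌ w)) (𝟙-≤T-⋌ {w′ = w₀} {w = w} ∣u₀∣))
            (𝟙-distrib-* (u₀ ≤T? u) (w₀ ≤T? w) μ-⋌)

    module μ-⋌-Step {u₀ w₀ u w : Tree} (u₀≤u : u₀ ≤T u) (w₀≤w : w₀ ≤T w) (off-top : u₀ ≢ u ⊎ w₀ ≢ w)
      (below-top : ∀ {u′ w′} → u′ ≤T u → w′ ≤T w → u′ ≢ u ⊎ w′ ≢ w →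
                   u₀ ≤T u′ → w₀ ≤T w′ → μ (u₀ ⋌ w₀) (u′ ⋌ w′) ≡ μ u₀ u′ * μ w₀ w′) where

      D : ℤ
      D = μ (u₀ ⋌ w₀) (u ⋌ w) - μ u₀ u * μ w₀ w

      off-diagonal : ∀ {u′ w′} → u′ ∈ ↓ u → w′ ∈ ↓ w → u′ ≢ u ⊎ w′ ≢ w →
        μ↑ (u₀ ⋌ w₀) (u′ ⋌ w′) ≡ μ↑ u₀ u′ * μ↑ w₀ w′
      off-diagonal u′∈ w′∈ off =
        μ↑-⋌ (trans (≤T-leaves u₀≤u) (sym (≤T-leaves (∈↓⇒≤T u u′∈))))
             (below-top (∈↓⇒≤T u u′∈) (∈↓⇒≤T w w′∈) off)

      -- The with abstracts u′ ≟T u and w′ ≟T w inside δ u′ u and δ w′ w as well, so they compute.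
      defect : ∀ {u′ w′} → u′ ∈ ↓ u → w′ ∈ ↓ w →
        μ↑ (u₀ ⋌ w₀) (u′ ⋌ w′) ≡ μ↑ u₀ u′ * μ↑ w₀ w′ + δ u′ u * (δ w′ w * D)
      defect {u′} {w′} u′∈ w′∈ with u′ ≟T u | w′ ≟T w
      ... | yes refl | yes refl = begin
        μ↑ (u₀ ⋌ w₀) (u ⋌ w)               ≡⟨ μ↑-≤T (⋌-mono u₀≤u w₀≤w) ⟩
        μ (u₀ ⋌ w₀) (u ⋌ w)                ≡⟨ split (μ (u₀ ⋌ w₀) (u ⋌ w)) (μ u₀ u * μ w₀ w) ⟩
        μ u₀ u * μ w₀ w + 1ℤ * (1ℤ * D)    ≡⟨ cong (_+ 1ℤ * (1ℤ * D)) (cong₂ _*_ (μ↑-≤T u₀≤u) (μ↑-≤T w₀≤w)) ⟨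
        μ↑ u₀ u * μ↑ w₀ w + 1ℤ * (1ℤ * D)  ∎
        where
        split : ∀ m p → m ≡ p + 1ℤ * (1ℤ * (m - p))
        split = solve-∀
      ... | no u′≢u | _       = trans (off-diagonal u′∈ w′∈ (inj₁ u′≢u)) (sym (ℤₚ.+-identityʳ _))
      ... | yes _   | no w′≢w = trans (off-diagonal u′∈ w′∈ (inj₂ w′≢w)) (sym (ℤₚ.+-identityʳ _))

      product-vanishes : ∑ (↓ u) (μ↑ u₀) * ∑ (↓ w) (μ↑ w₀) ≡ 0ℤ
      product-vanishes =
        [ (λ u₀≢u → cong (_* ∑ (↓ w) (μ↑ w₀)) (∑-↓-μ↑ u₀≤u u₀≢u))
        , (λ w₀≢w → trans (cong (∑ (↓ u) (μ↑ u₀) *_) (∑-↓-μ↑ w₀≤w w₀≢w)) (ℤₚ.*-zeroʳ (∑ (↓ u) (μ↑ u₀))))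
        ]′ off-top

      u₀⋌w₀≢u⋌w : u₀ ⋌ w₀ ≢ u ⋌ w
      u₀⋌w₀≢u⋌w e with ⋌-injective (≤T-leaves u₀≤u) e
      ... | u₀≡u , w₀≡w = [ (λ u₀≢u → u₀≢u u₀≡u) , (λ w₀≢w → w₀≢w w₀≡w) ]′ off-top

      -- Both vanishing sums, over [u₀ ⋌ w₀ , u ⋌ w] and over [u₀ , u] × [w₀ , w], expand to
      -- double sums over ↓ u × ↓ w whose terms differ only at (u , w), and there by D.
      D≡0 : D ≡ 0ℤ
      D≡0 = sym (begin
        0ℤ
          ≡⟨ ∑-↓-μ↑ (⋌-mono u₀≤u w₀≤w) u₀⋌w₀≢u⋌w ⟨
        ∑ (↓ (u ⋌ w)) (μ↑ (u₀ ⋌ w₀))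
          ≡⟨ ∑-↓-⋌ u w (μ↑ (u₀ ⋌ w₀)) ⟩
        ∑[ u′ ∈ ↓ u ] ∑[ w′ ∈ ↓ w ] μ↑ (u₀ ⋌ w₀) (u′ ⋌ w′)
          ≡⟨ ∑-cong (↓ u) (λ u′∈ → ∑-cong (↓ w) (λ w′∈ → defect u′∈ w′∈)) ⟩
        ∑[ u′ ∈ ↓ u ] ∑[ w′ ∈ ↓ w ] (μ↑ u₀ u′ * μ↑ w₀ w′ + δ u′ u * (δ w′ w * D))
          ≡⟨ ∑∑-+ (↓ u) (↓ w) (λ u′ w′ → μ↑ u₀ u′ * μ↑ w₀ w′) (λ u′ w′ → δ u′ u * (δ w′ w * D)) ⟩
        ∑[ u′ ∈ ↓ u ] ∑[ w′ ∈ ↓ w ] (μ↑ u₀ u′ * μ↑ w₀ w′)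
          + ∑[ u′ ∈ ↓ u ] ∑[ w′ ∈ ↓ w ] (δ u′ u * (δ w′ w * D))
          ≡⟨ cong₂ _+_ (∑-*-∑ (↓ u) (↓ w) (μ↑ u₀) (μ↑ w₀))
                       (∑-*-∑ (↓ u) (↓ w) (λ u′ → δ u′ u) (λ w′ → δ w′ w * D)) ⟩
        ∑ (↓ u) (μ↑ u₀) * ∑ (↓ w) (μ↑ w₀) + multiplicity (↓ u) u * ∑[ w′ ∈ ↓ w ] (δ w′ w * D)
          ≡⟨ cong₂ _+_ product-vanishes (cong₂ _*_ (multiplicity-↓-top u) (∑-δ (↓ w) w (λ _ → D))) ⟩
        0ℤ + 1ℤ * (multiplicity (↓ w) w * D)
          ≡⟨ cong (λ m → 0ℤ + 1ℤ * (m * D)) (multiplicity-↓-top w) ⟩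
        0ℤ + 1ℤ * (1ℤ * D)
          ≡⟨ unit D ⟩
        D ∎)
        where
        unit : ∀ d → 0ℤ + 1ℤ * (1ℤ * d) ≡ d
        unit = solve-∀

      μ-⋌-step : μ (u₀ ⋌ w₀) (u ⋌ w) ≡ μ u₀ u * μ w₀ w
      μ-⋌-step = ℤₚ.i-j≡0⇒i≡j _ _ D≡0

    μ-⋌ : ∀ {u₀ w₀ u w} → u₀ ≤T u → w₀ ≤T w → μ (u₀ ⋌ w₀) (u ⋌ w) ≡ μ u₀ u * μ w₀ w
    μ-⋌ = go (<-wellFounded _)
      where
      go : ∀ {u₀ w₀ u w} → Acc _<_ (rank u ℕ.+ rank w) →
        u₀ ≤T u → w₀ ≤T w → μ (u₀ ⋌ w₀) (u ⋌ w) ≡ μ u₀ u * μ w₀ w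
      go {u₀} {w₀} {u} {w} (acc rs) u₀≤u w₀≤w with u₀ ≟T u | w₀ ≟T w
      ... | yes refl | yes refl =
        trans (proj₁ isMöbius (u₀ ⋌ w₀)) (sym (cong₂ _*_ (proj₁ isMöbius u₀) (proj₁ isMöbius w₀)))
      ... | no u₀≢u  | _        =
        μ-⋌-Step.μ-⋌-step u₀≤u w₀≤w (inj₁ u₀≢u) λ p q off → go (rs (rank-+-< p q off))
      ... | yes _    | no w₀≢w  =
        μ-⋌-Step.μ-⋌-step u₀≤u w₀≤w (inj₂ w₀≢w) λ p q off → go (rs (rank-+-< p q off))

    M-⋌ : ∀ u w → M μ (u ⋌ w) ≈L (M μ u ⋌L M μ w)
    M-⋌ u w x = begin
      coeff (M μ (u ⋌ w)) x
        ≡⟨ coeff-as-eval (M μ (u ⋌ w)) x ⟩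
      eval (λ z → δ z x) (M μ (u ⋌ w))
        ≡⟨ eval-M μ (u ⋌ w) (λ z → δ z x) ⟩
      ∑[ z ∈ ↓ (u ⋌ w) ] (μ z (u ⋌ w) * δ z x)
        ≡⟨ ∑-↓-⋌ u w (λ z → μ z (u ⋌ w) * δ z x) ⟩
      ∑[ u′ ∈ ↓ u ] ∑[ w′ ∈ ↓ w ] (μ (u′ ⋌ w′) (u ⋌ w) * δ (u′ ⋌ w′) x)
        ≡⟨ ∑-cong (↓ u) (λ {u′} u′∈ → ∑-cong (↓ w) λ {w′} w′∈ →
             trans (cong (_* δ (u′ ⋌ w′) x) (μ-⋌ (∈↓⇒≤T u u′∈) (∈↓⇒≤T w w′∈)))
                   (ℤₚ.*-assoc (μ u′ u) (μ w′ w) (δ (u′ ⋌ w′) x))) ⟩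
      ∑[ u′ ∈ ↓ u ] ∑[ w′ ∈ ↓ w ] (μ u′ u * (μ w′ w * δ (u′ ⋌ w′) x))
        ≡⟨ ∑-cong (↓ u) (λ {u′} _ → sym (∑-*ˡ (μ u′ u) (↓ w) (λ w′ → μ w′ w * δ (u′ ⋌ w′) x))) ⟩
      ∑[ u′ ∈ ↓ u ] (μ u′ u * ∑[ w′ ∈ ↓ w ] (μ w′ w * δ (u′ ⋌ w′) x))
        ≡⟨ ∑-cong (↓ u) (λ {u′} _ → cong (μ u′ u *_) (eval-M μ w (λ w′ → δ (u′ ⋌ w′) x))) ⟨
      ∑[ u′ ∈ ↓ u ] (μ u′ u * eval (λ w′ → δ (u′ ⋌ w′) x) (M μ w))
        ≡⟨ eval-M μ u (λ u′ → eval (λ w′ → δ (u′ ⋌ w′) x) (M μ w)) ⟨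
      eval (λ u′ → eval (λ w′ → δ (u′ ⋌ w′) x) (M μ w)) (M μ u)
        ≡⟨ coeff-⋌L (M μ u) (M μ w) x ⟨
      coeff (M μ u ⋌L M μ w) x
        ∎

    M-⋌-prod : ∀ ts {s A} → M μ s ≈L A → M μ (⋌-prod s ts) ≈L ⋌L-prod A (map (M μ) ts)
    M-⋌-prod []       M≈A = M≈A
    M-⋌-prod (t ∷ ts) {s} {A} M≈A =
      M-⋌-prod ts λ x → trans (M-⋌ s t x) (⋌L-congˡ (M μ s) A (M μ t) M≈A x)

-- M is multiplicative along every ⋌-factorisation.
lemma2p32 : (_≤T?_ : Decidable _≤T_) (μ : Tree → Tree → ℤ) → Tamari.IsMöbius _≤T?_ μ →
    (t₁ : Tree) (ts : List Tree) → Irreducible t₁ → All Irreducible ts →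
    Tamari.M _≤T?_ μ (⋌-prod t₁ ts) ≈L Tamari.⋌L-prod _≤T?_ (Tamari.M _≤T?_ μ t₁) (map (Tamari.M _≤T?_ μ) ts)
lemma2p32 _≤T?_ μ isMöbius t₁ ts _ _ = M-⋌-prod _≤T?_ μ isMöbius ts (λ _ → refl)
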